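{- Let $A$ be a deterministic max-finding algorithm that makes $O(n)$ comparisons on $n$ elements. Then $A$ has error at least $\log_2\log_2 n-O(1)$.
   Context: Model: each element $x_i$ has an unknown real value $\mathrm{val}(x_i)$. A comparator query on $x_i,x_j$ returns "$x_i\ge x_j$" or "$x_j\ge x_i$"; the answer is correct if $|\mathrm{val}(x_i)-\mathrm{val}(x_j)|>1$ and arbitrary (possibly adversarial) otherwise. The error of a max-finding algorithm is the least $k$ such that on every input and every consistent comparator behavior its output $x$ satisfies $\mathrm{val}(x)\ge\mathrm{val}(x_i)-k$ for all $i$. -}

module Defs where

open import Data.Nat as ℕ using (ℕ; zero; suc; _⊔_)
open import Data.Nat.Logarithm using (⌊log₂_⌋)
open import Data.Fin using (Fin)
open import Data.Bool using (Bool; true; false)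
open import Data.Integer using (+_)
open import Data.Rational using (ℚ; _≤_; _<_; _-_; ∣_∣; 1ℚ; _/_)
open import Data.Product using (Σ; ∃; _×_)

-- A deterministic (adaptive) comparison algorithm on n elements x_0..x_{n-1}:
-- a decision tree. 'query i j k' asks the comparator about (x_i, x_j);
-- answer 'true' means "x_i ≥ x_j", 'false' means "x_j ≥ x_i".
data Alg (n : ℕ) : Set where
  output : Fin n → Alg n
  query  : Fin n → Fin n → (Bool → Alg n) → Alg n

depth : ∀ {n} → Alg n → ℕ
depth (output _)    = 0
depth (query i j k) = suc (depth (k true) ⊔ depth (k false))

Correct : ∀ {n} → (Fin n → ℚ) → Fin n → Fin n → Bool → Set
Correct val i j true  = val j ≤ val i
Correct val i j false = val i ≤ val j

Allowed : ∀ {n} → (Fin n → ℚ) → Fin n → Fin n → Bool → Set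
Allowed val i j b = 1ℚ < ∣ val i - val j ∣ → Correct val i j b

-- 'Outputs val A x': some consistent (possibly adaptive/adversarial)
-- comparator behaviour on the input with values 'val' makes A output x
data Outputs {n} (val : Fin n → ℚ) : Alg n → Fin n → Set where
  out : ∀ {x} → Outputs val (output x) x
  ask : ∀ {i j k x} (b : Bool) → Allowed val i j b →
        Outputs val (k b) x → Outputs val (query i j k) x

ErrorAtLeast : ∀ {n} → Alg n → ℚ → Set
ErrorAtLeast {n} A L =
  Σ (Fin n → ℚ) λ val → Σ (Fin n) λ x → Outputs val A x ×
    Σ (Fin n) λ i → L ≤ val i - val x

ℕ→ℚ : ℕ → ℚ
ℕ→ℚ m = + m / 1

-- ⌊log₂ ⌊log₂ n⌋⌋ (differs from log₂ log₂ n by O(1))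
loglog : ℕ → ℕ
loglog n = ⌊log₂ ⌊log₂ n ⌋ ⌋

module Submission where

-- The degree adversary answers each query in favour of the element that has
-- so far taken part in fewer comparisons; its answers form a transcript of
-- edges winner → loser.  Let x be the output.  As no winner is busier than its
-- loser, each element beats at most t elements of final degree below t, and at
-- most 2|E|/t elements have degree ≥ t; so the ball of radius r + 1 around x
-- has size at most (1 + t)·|ball r| + 2|E|/t, and for |E| = O(n) the ball of
-- radius log₂ log₂ n − O(1) misses an element y (ball-small).  Valuing every
-- element by its distance from x, capped at L, explains every answer, while y
-- lies L above x (adversary-error).

open import Defs
open import Data.Nat using (ℕ; NonZero; _≤_; _*_)
open import Data.Rational using (_-_)
open import Data.Product using (∃; ∃₂)

open import Data.Nat using (>-nonZero; >-nonZero⁻¹; zero; suc; _+_; _<_; _≤ᵇ_; _^_; _∸_; _⊔_; z≤n; s≤s; ⌊_/2⌋; ⌈_/2⌉)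
open import Data.Nat.Properties
open import Data.Nat.Logarithm using (⌊log₂_⌋; ⌊log₂⌋-mono-≤; ⌊log₂⌊n/2⌋⌋≡⌊log₂n⌋∸1)
open import Data.Nat.Induction using (<-wellFounded)
open import Data.Nat.Tactic.RingSolver using (solve-∀)
import Data.Nat.ListAction as ℕ-List
open import Algebra.Properties.Semiring.Sum +-*-semiring
  using (sum-syntax; sum-cong-≗; ∑-distrib-+; *-distribˡ-sum; sum-replicate-zero)
open import Data.Fin using (Fin; zero; suc)
import Data.Fin.Properties as Fin
open import Data.Bool as Bool using (Bool; true; false; _∧_; _∨_; not)
open import Data.Bool.ListAction using (any)
open import Data.List using (List; []; _∷_; length; map)
open import Data.List.Membership.Propositional using (_∈_)
open import Data.List.Relation.Unary.Any as Any using (here; there)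
open import Data.List.Relation.Unary.Any.Properties using (any⁺)
open import Data.Bool.Properties using (∨-zeroʳ; ∨-conicalˡ; T-≡)
open import Function.Bundles using (Equivalence)
open import Data.Product using (Σ; _×_; _,_; proj₁; proj₂)
open import Data.Unit using (⊤; tt)
open import Data.Empty using (⊥-elim)
open import Data.Integer as ℤ using (_⊖_)
import Data.Integer.Properties as ℤₚ
import Data.Rational as ℚ
import Data.Rational.Properties as ℚₚ
import Data.Nat.Coprimality as Coprime
open import Induction.WellFounded using (Acc; acc)
open import Relation.Binary.PropositionalEquality
open import Relation.Nullary using (Dec; does; yes; no)
open import Relation.Nullary.Decidable using (dec-true)

⟦_⟧ : Bool → ℕ
⟦ true ⟧  = 1
⟦ false ⟧ = 0

⟦⟧≤1 : ∀ b → ⟦ b ⟧ ≤ 1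
⟦⟧≤1 true  = ≤-refl
⟦⟧≤1 false = z≤n

_==_ : ∀ {n} → Fin n → Fin n → Bool
u == v = does (u Fin.≟ v)

==-refl : ∀ {n} (u : Fin n) → (u == u) ≡ true
==-refl u = dec-true (u Fin.≟ u) refl

∣_∣ : ∀ {n} → (Fin n → Bool) → ℕ
∣_∣ {n} B = ∑[ w < n ] ⟦ B w ⟧

∑-mono : ∀ {n} {f g : Fin n → ℕ} → (∀ w → f w ≤ g w) → ∑[ w < n ] f w ≤ ∑[ w < n ] g w
∑-mono {zero}  f≤g = z≤n
∑-mono {suc n} f≤g = +-mono-≤ (f≤g zero) (∑-mono (λ w → f≤g (suc w)))

∑-point : ∀ {n} (a : Fin n) (g : Fin n → ℕ) → ∑[ w < n ] (⟦ a == w ⟧ * g w) ≡ g a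
∑-point {suc n} zero g = begin
  g zero + 0 + ∑[ w < n ] 0  ≡⟨ cong (g zero + 0 +_) (sum-replicate-zero n) ⟩
  g zero + 0 + 0             ≡⟨ +-identityʳ _ ⟩
  g zero + 0                 ≡⟨ +-identityʳ _ ⟩
  g zero                     ∎
  where open ≡-Reasoning
∑-point {suc n} (suc a) g = ∑-point a (λ w → g (suc w))

∑-single : ∀ {n} (a : Fin n) → ∑[ w < n ] ⟦ a == w ⟧ ≡ 1
∑-single a = trans (sum-cong-≗ (λ w → sym (*-identityʳ ⟦ a == w ⟧))) (∑-point a (λ _ → 1))

missesVertex : ∀ {n} (B : Fin n → Bool) → ∣ B ∣ < n → Σ (Fin n) λ y → B y ≡ false
missesVertex {suc n} B small with B zero in B₀
... | false = zero , B₀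
... | true  = let y , By = missesVertex (λ w → B (suc w)) (+-cancelˡ-< 1 _ _ small) in suc y , By

∑ᴸ : ∀ {A : Set} → List A → (A → ℕ) → ℕ
∑ᴸ xs f = ℕ-List.sum (map f xs)

infixl 10 ∑ᴸ
syntax ∑ᴸ xs (λ x → t) = ∑[ x ∈ xs ] t

∑ᴸ-mono : ∀ {A : Set} (xs : List A) {f g : A → ℕ} → (∀ x → f x ≤ g x) → ∑ᴸ xs f ≤ ∑ᴸ xs g
∑ᴸ-mono []       f≤g = z≤n
∑ᴸ-mono (x ∷ xs) f≤g = +-mono-≤ (f≤g x) (∑ᴸ-mono xs f≤g)

∑ᴸ-cong : ∀ {A : Set} (xs : List A) {f g : A → ℕ} → (∀ x → f x ≡ g x) → ∑ᴸ xs f ≡ ∑ᴸ xs g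
∑ᴸ-cong []       f≡g = refl
∑ᴸ-cong (x ∷ xs) f≡g = cong₂ _+_ (f≡g x) (∑ᴸ-cong xs f≡g)

∑ᴸ-*ˡ : ∀ {A : Set} (xs : List A) k (f : A → ℕ) → ∑[ x ∈ xs ] (k * f x) ≡ k * ∑ᴸ xs f
∑ᴸ-*ˡ []       k f = sym (*-zeroʳ k)
∑ᴸ-*ˡ (x ∷ xs) k f = trans (cong (k * f x +_) (∑ᴸ-*ˡ xs k f)) (sym (*-distribˡ-+ k _ _))

∑ᴸ-const : ∀ {A : Set} (xs : List A) k → ∑[ x ∈ xs ] k ≡ k * length xs
∑ᴸ-const []       k = sym (*-zeroʳ k)
∑ᴸ-const (x ∷ xs) k = trans (cong (k +_) (∑ᴸ-const xs k)) (sym (*-suc k (length xs)))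

∑-exchange : ∀ {A : Set} {n} (xs : List A) (f : A → Fin n → ℕ) →
             ∑[ x ∈ xs ] ∑[ w < n ] f x w ≡ ∑[ w < n ] ∑[ x ∈ xs ] f x w
∑-exchange {n = n} []       f = sym (sum-replicate-zero n)
∑-exchange         (x ∷ xs) f =
  trans (cong (∑[ w < _ ] f x w +_) (∑-exchange xs f)) (sym (∑-distrib-+ (f x) _))

-- An edge (u , v) of a transcript records that u was declared to beat v.
Edge : ℕ → Set
Edge n = Fin n × Fin n

winner loser : ∀ {n} → Edge n → Fin n
winner = proj₁
loser  = proj₂

deg : ∀ {n} → List (Edge n) → Fin n → ℕ
deg E v = ∑[ e ∈ E ] (⟦ winner e == v ⟧ + ⟦ loser e == v ⟧)

∑-deg : ∀ {n} (E : List (Edge n)) → ∑[ v < n ] deg E v ≡ 2 * length E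
∑-deg {n} E = begin
  ∑[ v < n ] deg E v
    ≡⟨ ∑-exchange E endpoint ⟨
  ∑[ e ∈ E ] ∑[ v < n ] endpoint e v
    ≡⟨ ∑ᴸ-cong E (λ e → trans (∑-distrib-+ (λ v → ⟦ winner e == v ⟧) _)
                               (cong₂ _+_ (∑-single (winner e)) (∑-single (loser e)))) ⟩
  ∑[ e ∈ E ] 2
    ≡⟨ ∑ᴸ-const E 2 ⟩
  2 * length E ∎
  where
  open ≡-Reasoning
  endpoint : Edge n → Fin n → ℕ
  endpoint e v = ⟦ winner e == v ⟧ + ⟦ loser e == v ⟧

edge : ∀ {n} → Fin n → Fin n → Bool → Edge n
edge i j true  = i , j
edge i j false = j , i

answer : ∀ {n} → List (Edge n) → Fin n → Fin n → Bool
answer E i j = does (deg E i ≤? deg E j)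

-- Running the algorithm against the degree adversary, starting from the
-- transcript E (newest edge first), yields its output and the full transcript.
play : ∀ {n} → Alg n → List (Edge n) → Fin n × List (Edge n)
play (output x)    E = x , E
play (query i j k) E = play (k (answer E i j)) (edge i j (answer E i j) ∷ E)

WinnerNotBusier : ∀ {n} → List (Edge n) → Set
WinnerNotBusier []      = ⊤
WinnerNotBusier (e ∷ E) = deg E (winner e) ≤ deg E (loser e) × WinnerNotBusier E

adversary-answer : ∀ {n} (E : List (Edge n)) i j →
                   let e = edge i j (answer E i j) in deg E (winner e) ≤ deg E (loser e)
adversary-answer E i j = by-decision (deg E i ≤? deg E j)
  where
  by-decision : (d : Dec (deg E i ≤ deg E j)) →
                let e = edge i j (does d) in deg E (winner e) ≤ deg E (loser e)
  by-decision (yes i≤j) = i≤j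
  by-decision (no  i≰j) = <⇒≤ (≰⇒> i≰j)

play-winnerNotBusier : ∀ {n} (A : Alg n) E → WinnerNotBusier E → WinnerNotBusier (proj₂ (play A E))
play-winnerNotBusier (output x)    E ok = ok
play-winnerNotBusier (query i j k) E ok = play-winnerNotBusier (k _) _ (adversary-answer E i j , ok)

play-extends : ∀ {n} (A : Alg n) E {e} → e ∈ E → e ∈ proj₂ (play A E)
play-extends (output x)    E e∈E = e∈E
play-extends (query i j k) E e∈E = play-extends (k _) _ (there e∈E)

branch-depth : ∀ {n} (k : Bool → Alg n) b → depth (k b) ≤ depth (k true) ⊔ depth (k false)
branch-depth k true  = m≤m⊔n _ _
branch-depth k false = m≤n⊔m _ _

play-length : ∀ {n} (A : Alg n) E → length (proj₂ (play A E)) ≤ depth A + length E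
play-length (output x)    E = ≤-refl
play-length (query i j k) E = begin
  length (proj₂ (play (k b) (edge i j b ∷ E)))  ≤⟨ play-length (k b) _ ⟩
  depth (k b) + suc (length E)                   ≡⟨ +-suc _ _ ⟩
  suc (depth (k b)) + length E                   ≤⟨ +-monoˡ-≤ (length E) (s≤s (branch-depth k b)) ⟩
  depth (query i j k) + length E                 ∎
  where
  open ≤-Reasoning
  b : Bool
  b = answer E i j

ℕ→ℚ-normal : ∀ m → ℕ→ℚ m ≡ ℚ.mkℚ (ℤ.+ m) 0 (Coprime.sym (Coprime.1-coprimeTo m))
ℕ→ℚ-normal m = ℚₚ.normalize-coprime (Coprime.sym (Coprime.1-coprimeTo m))

ℕ→ℚ-mono : ∀ {m k} → m ≤ k → ℕ→ℚ m ℚ.≤ ℕ→ℚ k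
ℕ→ℚ-mono {m} {k} m≤k rewrite ℕ→ℚ-normal m | ℕ→ℚ-normal k =
  ℚ.*≤* (subst₂ ℤ._≤_ (sym (ℤₚ.*-identityʳ (ℤ.+ m))) (sym (ℤₚ.*-identityʳ (ℤ.+ k))) (ℤ.+≤+ m≤k))

m⊖1+m≡-1 : ∀ m → m ⊖ suc m ≡ ℤ.-[1+ 0 ]
m⊖1+m≡-1 zero    = refl
m⊖1+m≡-1 (suc m) = trans (ℤₚ.[1+m]⊖[1+n]≡m⊖n m (suc m)) (m⊖1+m≡-1 m)

1+m⊖m≡1 : ∀ m → suc m ⊖ m ≡ ℤ.+ 1
1+m⊖m≡1 zero    = refl
1+m⊖m≡1 (suc m) = trans (ℤₚ.[1+m]⊖[1+n]≡m⊖n (suc m) m) (1+m⊖m≡1 m)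

m-[1+m]≡-1 : ∀ m → ℕ→ℚ m - ℕ→ℚ (suc m) ≡ ℚ.- ℚ.1ℚ
m-[1+m]≡-1 m rewrite ℕ→ℚ-normal m | ℕ→ℚ-normal (suc m) | ℤₚ.*-identityʳ (ℤ.+ m) | *-identityʳ m
                   | m⊖1+m≡-1 m = refl

[1+m]-m≡1 : ∀ m → ℕ→ℚ (suc m) - ℕ→ℚ m ≡ ℚ.1ℚ
[1+m]-m≡1 zero    = refl
[1+m]-m≡1 (suc m) rewrite ℕ→ℚ-normal (suc m) | ℕ→ℚ-normal (suc (suc m)) | *-identityʳ m
                        | 1+m⊖m≡1 (suc m) = refl

-- Let the winner have value a and the loser value b ≤ a + 1.  Declaring the
-- winner larger is then always allowed: it could only be wrong if b = a + 1,
-- and then the values differ by exactly 1, so the comparator is free.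
nearlyBelow-allowed : ∀ {a b} → b ≤ suc a →
  (ℚ.1ℚ ℚ.< ℚ.∣ ℕ→ℚ a - ℕ→ℚ b ∣ → ℕ→ℚ b ℚ.≤ ℕ→ℚ a) ×
  (ℚ.1ℚ ℚ.< ℚ.∣ ℕ→ℚ b - ℕ→ℚ a ∣ → ℕ→ℚ b ℚ.≤ ℕ→ℚ a)
nearlyBelow-allowed {a} {b} b≤1+a with b ≤? a
... | yes b≤a = (λ _ → ℕ→ℚ-mono b≤a) , (λ _ → ℕ→ℚ-mono b≤a)
... | no  b≰a with refl ← ≤-antisym b≤1+a (≰⇒> b≰a) =
  unitGap (cong ℚ.∣_∣ (m-[1+m]≡-1 a)) , unitGap (cong ℚ.∣_∣ ([1+m]-m≡1 a))
  where
  unitGap : ∀ {d} → ℚ.∣ d ∣ ≡ ℚ.1ℚ → ℚ.1ℚ ℚ.< ℚ.∣ d ∣ → ℕ→ℚ (suc a) ℚ.≤ ℕ→ℚ a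
  unitGap ∣d∣≡1 1<∣d∣ = ⊥-elim (ℚₚ.<-irrefl (sym ∣d∣≡1) 1<∣d∣)

Explains : ∀ {n} → (Fin n → ℕ) → List (Edge n) → Set
Explains V E = ∀ {e} → e ∈ E → V (loser e) ≤ suc (V (winner e))

edge-allowed : ∀ {n} (V : Fin n → ℕ) i j b → let e = edge i j b in
               V (loser e) ≤ suc (V (winner e)) → Allowed (λ w → ℕ→ℚ (V w)) i j b
edge-allowed V i j true  Vj≤1+Vi = proj₁ (nearlyBelow-allowed Vj≤1+Vi)
edge-allowed V i j false Vi≤1+Vj = proj₂ (nearlyBelow-allowed Vi≤1+Vj)

play-outputs : ∀ {n} (V : Fin n → ℕ) (A : Alg n) E →
               Explains V (proj₂ (play A E)) → Outputs (λ w → ℕ→ℚ (V w)) A (proj₁ (play A E))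
play-outputs V (output x)    E explains = out
play-outputs V (query i j k) E explains =
  ask b (edge-allowed V i j b (explains (play-extends (k b) _ (here refl))))
        (play-outputs V (k b) _ explains)
  where
  b : Bool
  b = answer E i j

heavy : ∀ {n} → (Fin n → ℕ) → ℕ → Fin n → Bool
heavy D t v = t ≤ᵇ D v

heavy-true : ∀ {n} {D : Fin n → ℕ} {t v} → heavy D t v ≡ true → t ≤ D v
heavy-true {D = D} {t} {v} eq = ≤ᵇ⇒≤ t (D v) (Equivalence.from T-≡ eq)

heavy-false : ∀ {n} {D : Fin n → ℕ} {t v} → heavy D t v ≡ false → D v < t
heavy-false {D = D} {t} {v} eq = ≰⇒> (λ t≤Dv → subst Bool.T eq (≤⇒≤ᵇ t≤Dv))

lightWins : ∀ {n} → (Fin n → ℕ) → ℕ → List (Edge n) → Fin n → ℕ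
lightWins D t E u = ∑[ e ∈ E ] ⟦ (winner e == u) ∧ not (heavy D t (loser e)) ⟧

lightWins≤deg : ∀ {n} D t (E : List (Edge n)) u → lightWins D t E u ≤ deg E u
lightWins≤deg D t E u = ∑ᴸ-mono E (λ e → ≤-trans (∧-indicator (winner e == u) _) (m≤m+n _ _))
  where
  ∧-indicator : ∀ p q → ⟦ p ∧ q ⟧ ≤ ⟦ p ⟧
  ∧-indicator true  q = ⟦⟧≤1 q
  ∧-indicator false q = z≤n

deg-grows : ∀ {n} (e : Edge n) E v → deg E v ≤ deg (e ∷ E) v
deg-grows e E v = m≤n+m (deg E v) _

loser-deg-grows : ∀ {n} (e : Edge n) E → deg E (loser e) < deg (e ∷ E) (loser e)
loser-deg-grows (a , b) E rewrite ==-refl b = +-monoˡ-≤ (deg E b) (m≤n+m 1 ⟦ a == b ⟧)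

-- Key property of the degree adversary: in a transcript where every winner
-- was at most as busy as its loser, each vertex beats at most t vertices of
-- final degree below t.  When u beat such a v, u's earlier light wins numbered
-- at most deg u ≤ deg v < (final degree of v) < t.
lightWins-bound : ∀ {n} (D : Fin n → ℕ) t (E : List (Edge n)) → WinnerNotBusier E →
                  (∀ v → deg E v ≤ D v) → ∀ u → lightWins D t E u ≤ t
lightWins-bound D t []            _            _    u = z≤n
lightWins-bound D t ((a , b) ∷ E) (a≤b , notBusier) deg≤D u with a Fin.≟ u | heavy D t b in heavy-b
... | yes refl | false = begin-strict
  lightWins D t E a     ≤⟨ lightWins≤deg D t E a ⟩
  deg E a               ≤⟨ a≤b ⟩
  deg E b               <⟨ loser-deg-grows (a , b) E ⟩
  deg ((a , b) ∷ E) b   ≤⟨ deg≤D b ⟩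
  D b                   <⟨ heavy-false {D = D} heavy-b ⟩
  t                     ∎
  where open ≤-Reasoning
... | yes refl | true  = lightWins-bound D t E notBusier (λ v → ≤-trans (deg-grows (a , b) E v) (deg≤D v)) u
... | no  _    | _     = lightWins-bound D t E notBusier (λ v → ≤-trans (deg-grows (a , b) E v) (deg≤D v)) u

beatenBy : ∀ {n} → List (Edge n) → (Fin n → Bool) → Fin n → Bool
beatenBy E B w = any (λ e → B (winner e) ∧ (loser e == w)) E

expand : ∀ {n} → List (Edge n) → (Fin n → Bool) → Fin n → Bool
expand E B w = B w ∨ beatenBy E B w

beatenBy-witnessed : ∀ {n} (E : List (Edge n)) B w l →
  ⟦ beatenBy E B w ∧ l ⟧ ≤ ∑[ e ∈ E ] (⟦ loser e == w ⟧ * ⟦ B (winner e) ∧ l ⟧)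
beatenBy-witnessed []            B w l = z≤n
beatenBy-witnessed ((a , b) ∷ E) B w l =
  ≤-trans (first-or-rest (B a) (b == w) (beatenBy E B w) l)
          (+-monoʳ-≤ _ (beatenBy-witnessed E B w l))
  where
  first-or-rest : ∀ p q r l → ⟦ (p ∧ q ∨ r) ∧ l ⟧ ≤ ⟦ q ⟧ * ⟦ p ∧ l ⟧ + ⟦ r ∧ l ⟧
  first-or-rest true  true  r true  = s≤s z≤n
  first-or-rest true  true  r false = z≤n
  first-or-rest true  false r l     = ≤-refl
  first-or-rest false q     r l     = m≤n+m _ _

-- A vertex newly reached from B
-- is heavy (final degree ≥ t) or was beaten, as a light vertex, by a member of
-- B; each member of B has at most t light victims.
module Expansion {n} (E : List (Edge n)) (notBusier : WinnerNotBusier E) (t : ℕ) where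

  light : Fin n → Bool
  light v = not (heavy (deg E) t v)

  newLight≤edges : ∀ B → ∑[ w < n ] ⟦ beatenBy E B w ∧ light w ⟧ ≤
                         ∑[ e ∈ E ] ⟦ B (winner e) ∧ light (loser e) ⟧
  newLight≤edges B = begin
    ∑[ w < n ] ⟦ beatenBy E B w ∧ light w ⟧
      ≤⟨ ∑-mono (λ w → beatenBy-witnessed E B w (light w)) ⟩
    ∑[ w < n ] ∑[ e ∈ E ] (⟦ loser e == w ⟧ * ⟦ B (winner e) ∧ light w ⟧)
      ≡⟨ ∑-exchange E (λ e w → ⟦ loser e == w ⟧ * ⟦ B (winner e) ∧ light w ⟧) ⟨
    ∑[ e ∈ E ] ∑[ w < n ] (⟦ loser e == w ⟧ * ⟦ B (winner e) ∧ light w ⟧)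
      ≡⟨ ∑ᴸ-cong E (λ e → ∑-point (loser e) (λ w → ⟦ B (winner e) ∧ light w ⟧)) ⟩
    ∑[ e ∈ E ] ⟦ B (winner e) ∧ light (loser e) ⟧ ∎
    where open ≤-Reasoning

  edges≤t∣B∣ : ∀ B → ∑[ e ∈ E ] ⟦ B (winner e) ∧ light (loser e) ⟧ ≤ t * ∣ B ∣
  edges≤t∣B∣ B = begin
    ∑[ e ∈ E ] ⟦ B (winner e) ∧ light (loser e) ⟧
      ≡⟨ ∑ᴸ-cong E (λ e → ∑-point (winner e) (λ u → ⟦ B u ∧ light (loser e) ⟧)) ⟨
    ∑[ e ∈ E ] ∑[ u < n ] (⟦ winner e == u ⟧ * ⟦ B u ∧ light (loser e) ⟧)
      ≡⟨ ∑-exchange E (λ e u → ⟦ winner e == u ⟧ * ⟦ B u ∧ light (loser e) ⟧) ⟩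
    ∑[ u < n ] ∑[ e ∈ E ] (⟦ winner e == u ⟧ * ⟦ B u ∧ light (loser e) ⟧)
      ≡⟨ sum-cong-≗ (λ u → trans (∑ᴸ-cong E (λ e → swap (winner e == u) (B u) (light (loser e))))
                                  (∑ᴸ-*ˡ E ⟦ B u ⟧ _)) ⟩
    ∑[ u < n ] (⟦ B u ⟧ * lightWins (deg E) t E u)
      ≤⟨ ∑-mono (λ u → *-monoʳ-≤ ⟦ B u ⟧ (lightWins-bound (deg E) t E notBusier (λ _ → ≤-refl) u)) ⟩
    ∑[ u < n ] (⟦ B u ⟧ * t)
      ≡⟨ sum-cong-≗ (λ u → *-comm ⟦ B u ⟧ t) ⟩
    ∑[ u < n ] (t * ⟦ B u ⟧)
      ≡⟨ *-distribˡ-sum t (λ u → ⟦ B u ⟧) ⟨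
    t * ∣ B ∣ ∎
    where
    open ≤-Reasoning
    swap : ∀ q b l → ⟦ q ⟧ * ⟦ b ∧ l ⟧ ≡ ⟦ b ⟧ * ⟦ q ∧ l ⟧
    swap true  true  l = refl
    swap true  false l = refl
    swap false true  l = refl
    swap false false l = refl

  heavy-count : t * ∣ heavy (deg E) t ∣ ≤ 2 * length E
  heavy-count = begin
    t * ∣ heavy (deg E) t ∣                 ≡⟨ *-distribˡ-sum t (λ v → ⟦ heavy (deg E) t v ⟧) ⟩
    ∑[ v < n ] (t * ⟦ heavy (deg E) t v ⟧)  ≤⟨ ∑-mono t·heavy≤deg ⟩
    ∑[ v < n ] deg E v                      ≡⟨ ∑-deg E ⟩
    2 * length E                            ∎
    where
    open ≤-Reasoning
    t·heavy≤deg : ∀ v → t * ⟦ heavy (deg E) t v ⟧ ≤ deg E v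
    t·heavy≤deg v with heavy (deg E) t v in heavy-v
    ... | true  = ≤-trans (≤-reflexive (*-identityʳ t)) (heavy-true {D = deg E} heavy-v)
    ... | false = ≤-trans (≤-reflexive (*-zeroʳ t)) z≤n

  expand-size : ∀ B → ∣ expand E B ∣ ≤ ∣ B ∣ + (∣ heavy (deg E) t ∣ + t * ∣ B ∣)
  expand-size B = begin
    ∣ expand E B ∣
      ≤⟨ ∑-mono (λ w → split (B w) (beatenBy E B w) (heavy (deg E) t w)) ⟩
    ∑[ w < n ] (⟦ B w ⟧ + (⟦ heavy (deg E) t w ⟧ + ⟦ beatenBy E B w ∧ light w ⟧))
      ≡⟨ trans (∑-distrib-+ (λ w → ⟦ B w ⟧) _) (cong (∣ B ∣ +_) (∑-distrib-+ (λ w → ⟦ heavy (deg E) t w ⟧) _)) ⟩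
    ∣ B ∣ + (∣ heavy (deg E) t ∣ + ∑[ w < n ] ⟦ beatenBy E B w ∧ light w ⟧)
      ≤⟨ +-monoʳ-≤ ∣ B ∣ (+-monoʳ-≤ _ (≤-trans (newLight≤edges B) (edges≤t∣B∣ B))) ⟩
    ∣ B ∣ + (∣ heavy (deg E) t ∣ + t * ∣ B ∣) ∎
    where
    open ≤-Reasoning
    split : ∀ b r h → ⟦ b ∨ r ⟧ ≤ ⟦ b ⟧ + (⟦ h ⟧ + ⟦ r ∧ not h ⟧)
    split true  r     h     = s≤s z≤n
    split false true  true  = ≤-refl
    split false true  false = ≤-refl
    split false false h     = z≤n

ball : ∀ {n} → List (Edge n) → Fin n → ℕ → Fin n → Bool
ball E x zero    w = x == w
ball E x (suc r) w = expand E (ball E x r) w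

-- The arithmetic of one growth step: with threshold t = 4PQ, if the heavy
-- vertices number H with t·H ≤ Q·n and the old ball b satisfies 32P²Q·b ≤ n,
-- then the new ball b' ≤ b + (H + t·b) satisfies P·b' ≤ n.
growth-arith : ∀ {n P Q b b' H} → 1 ≤ P → 1 ≤ Q →
               (4 * P * Q) * H ≤ Q * n → (32 * P * P * Q) * b ≤ n →
               b' ≤ b + (H + (4 * P * Q) * b) → P * b' ≤ n
growth-arith {n} {P} {Q} {b} {b'} {H} 1≤P 1≤Q tH≤Qn old≤n b'≤ = *-cancelˡ-≤ 4 (begin
  4 * (P * b')                           ≤⟨ *-monoʳ-≤ 4 (*-monoʳ-≤ P b'≤) ⟩
  4 * (P * (b + (H + 4 * P * Q * b)))   ≡⟨ distribute P Q b H ⟩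
  4 * (P * H) + (4 * X + 16 * (Y * X))  ≤⟨ +-mono-≤ heavyPart ballPart ⟩
  n + n                                  ≤⟨ +-monoʳ-≤ n (m≤m+n n _) ⟩
  4 * n                                  ∎)
  where
  open ≤-Reasoning
  X Y : ℕ
  X = P * b
  Y = Q * P
  distribute : ∀ P Q b H → 4 * (P * (b + (H + 4 * P * Q * b))) ≡
                           4 * (P * H) + (4 * (P * b) + 16 * ((Q * P) * (P * b)))
  distribute = solve-∀
  heavyPart : 4 * (P * H) ≤ n
  heavyPart = *-cancelˡ-≤ Q ⦃ >-nonZero 1≤Q ⦄ (≤-trans (≤-reflexive (reorder P Q H)) tH≤Qn)
    where
    reorder : ∀ P Q H → Q * (4 * (P * H)) ≡ 4 * P * Q * H
    reorder = solve-∀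
  ballPart : 4 * X + 16 * (Y * X) ≤ n
  ballPart = begin
    4 * X + 16 * (Y * X)        ≤⟨ +-monoˡ-≤ (16 * (Y * X)) (*-monoʳ-≤ 4 X≤YX) ⟩
    4 * (Y * X) + 16 * (Y * X)  ≡⟨ *-distribʳ-+ (Y * X) 4 16 ⟨
    20 * (Y * X)                ≤⟨ *-monoˡ-≤ (Y * X) (m≤m+n 20 12) ⟩
    32 * (Y * X)                ≡⟨ regroup P Q b ⟩
    32 * P * P * Q * b          ≤⟨ old≤n ⟩
    n                           ∎
    where
    X≤YX : X ≤ Y * X
    X≤YX = m≤n*m X Y ⦃ >-nonZero (*-mono-≤ 1≤Q 1≤P) ⦄
    regroup : ∀ P Q b → 32 * ((Q * P) * (P * b)) ≡ 32 * P * P * Q * b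
    regroup = solve-∀

2^[g+g+a+5] : ∀ g a → 2 ^ (g + g + a + 5) ≡ 32 * 2 ^ g * 2 ^ g * 2 ^ a
2^[g+g+a+5] g a = begin
  2 ^ (g + g + a + 5)            ≡⟨ ^-distribˡ-+-* 2 (g + g + a) 5 ⟩
  2 ^ (g + g + a) * 32           ≡⟨ cong (_* 32) (^-distribˡ-+-* 2 (g + g) a) ⟩
  2 ^ (g + g) * 2 ^ a * 32       ≡⟨ cong (λ p → p * 2 ^ a * 32) (^-distribˡ-+-* 2 g g) ⟩
  2 ^ g * 2 ^ g * 2 ^ a * 32     ≡⟨ reorder (2 ^ g) (2 ^ a) ⟩
  32 * 2 ^ g * 2 ^ g * 2 ^ a     ∎
  where
  open ≡-Reasoning
  reorder : ∀ p q → p * p * q * 32 ≡ 32 * p * p * q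
  reorder = solve-∀

-- By induction on r, with the
-- threshold t = 4·2^g·2^a: the ball of radius r + 1 is small for g because the
-- ball of radius r is small for 2g + a + 5, which doubles the required budget.
ball-small : ∀ {n} (E : List (Edge n)) → WinnerNotBusier E → ∀ a N →
             2 ^ N ≤ n → 2 * length E ≤ 2 ^ a * n →
             ∀ x r g → (g + (a + 5)) * 2 ^ r ≤ N → 2 ^ g * ∣ ball E x r ∣ ≤ n
ball-small {n} E notBusier a N 2^N≤n short x zero g budget = begin
  2 ^ g * ∣ ball E x zero ∣  ≡⟨ cong (2 ^ g *_) (∑-single x) ⟩
  2 ^ g * 1                  ≡⟨ *-identityʳ (2 ^ g) ⟩
  2 ^ g                      ≤⟨ ^-monoʳ-≤ 2 g≤N ⟩
  2 ^ N                      ≤⟨ 2^N≤n ⟩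
  n                          ∎
  where
  open ≤-Reasoning
  g≤N : g ≤ N
  g≤N = ≤-trans (m≤m+n g (a + 5)) (≤-trans (≤-reflexive (sym (*-identityʳ _))) budget)
ball-small {n} E notBusier a N 2^N≤n short x (suc r) g budget =
  growth-arith (m^n>0 2 g) (m^n>0 2 a) (≤-trans heavy-count short) smaller
               (expand-size (ball E x r))
  where
  open Expansion E notBusier (4 * 2 ^ g * 2 ^ a)
  g′ : ℕ
  g′ = g + g + a + 5
  budget′ : (g′ + (a + 5)) * 2 ^ r ≤ N
  budget′ = ≤-trans (≤-reflexive (regroup g a (2 ^ r))) budget
    where
    regroup : ∀ g a p → (g + g + a + 5 + (a + 5)) * p ≡ (g + (a + 5)) * (2 * p)
    regroup = solve-∀
  smaller : (32 * 2 ^ g * 2 ^ g * 2 ^ a) * ∣ ball E x r ∣ ≤ n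
  smaller = subst (λ c → c * ∣ ball E x r ∣ ≤ n) (2^[g+g+a+5] g a)
                  (ball-small E notBusier a N 2^N≤n short x r g′ budget′)

any-member : ∀ {A : Set} (p : A → Bool) {xs : List A} {e} → e ∈ xs → p e ≡ true → any p xs ≡ true
any-member p e∈xs pe = Equivalence.to T-≡ (any⁺ p (Any.map (λ { refl → Equivalence.from T-≡ pe }) e∈xs))

module Distances {n} (E : List (Edge n)) (x : Fin n) where

  centre-in-ball : ∀ r → ball E x r x ≡ true
  centre-in-ball zero    = ==-refl x
  centre-in-ball (suc r) rewrite centre-in-ball r = refl

  ball-edge : ∀ {u v} → (u , v) ∈ E → ∀ r → ball E x r u ≡ true → ball E x (suc r) v ≡ true
  ball-edge {u} {v} uv∈E r u∈ball =
    trans (cong (ball E x r v ∨_) (any-member (λ e → ball E x r (winner e) ∧ (loser e == v)) uv∈E v-reached))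
          (∨-zeroʳ _)
    where
    v-reached : (ball E x r u ∧ (v == v)) ≡ true
    v-reached rewrite u∈ball = ==-refl v

  -- The number of radii below L whose ball misses w: the distance from x to w, capped at L.
  missed : Fin n → ℕ → ℕ
  missed w zero    = 0
  missed w (suc L) = missed w L + ⟦ not (ball E x L w) ⟧

  missed-centre : ∀ L → missed x L ≡ 0
  missed-centre zero = refl
  missed-centre (suc L) rewrite missed-centre L | centre-in-ball L = refl

  missed-outside : ∀ {y} L → ball E x L y ≡ false → missed y L ≡ L
  missed-outside         zero    _    = refl
  missed-outside {y} (suc L) miss with inner ← ∨-conicalˡ (ball E x L y) _ miss
    rewrite missed-outside L inner | inner = +-comm L 1

  missed-edge : ∀ {u v} → (u , v) ∈ E → ∀ L → missed v L ≤ suc (missed u L)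
  missed-edge uv∈E L = ≤-trans (m≤m+n _ _) (shifted uv∈E L)
    where
    shifted : ∀ {u v} → (u , v) ∈ E → ∀ L → missed v (suc L) ≤ suc (missed u L)
    shifted {u} {v} uv∈E zero    = ⟦⟧≤1 (not (ball E x zero v))
    shifted {u} {v} uv∈E (suc L) = +-mono-≤ (shifted uv∈E L) last-step
      where
      last-step : ⟦ not (ball E x (suc L) v) ⟧ ≤ ⟦ not (ball E x L u) ⟧
      last-step with ball E x L u in u∈ball
      ... | true  rewrite ball-edge uv∈E L u∈ball = z≤n
      ... | false = ⟦⟧≤1 _

-- Let x be the output and E the transcript of the run against the degree
-- adversary.  If the ball of radius L around x misses a vertex y, then the
-- values V = C + (distance from x capped at L) explain the transcript, so the
-- algorithm may output x although V(y) = V(x) + L.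
adversary-error : ∀ {n} (A : Alg n) C L →
                  let (x , E) = play A [] in ∣ ball E x L ∣ < n →
                  ErrorAtLeast A (ℕ→ℚ (C + L) - ℕ→ℚ C)
adversary-error {n} A C L small =
  (λ w → ℕ→ℚ (V w)) , x , play-outputs V A [] explains , y , gap
  where
  x : Fin n
  x = proj₁ (play A [])
  E : List (Edge n)
  E = proj₂ (play A [])
  open Distances E x
  V : Fin n → ℕ
  V w = C + missed w L
  outside : Σ (Fin n) λ y → ball E x L y ≡ false
  outside = missesVertex (ball E x L) small
  y : Fin n
  y = proj₁ outside
  explains : Explains V E
  explains uv∈E = ≤-trans (+-monoʳ-≤ C (missed-edge uv∈E L)) (≤-reflexive (+-suc C _))
  gap : ℕ→ℚ (C + L) - ℕ→ℚ C ℚ.≤ ℕ→ℚ (V y) - ℕ→ℚ (V x)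
  gap rewrite missed-outside L (proj₂ outside) | missed-centre L | +-identityʳ C = ℚₚ.≤-refl

-- A non-positive error bound holds trivially: with all values equal every
-- answer is allowed, so the adversary run is consistent.
error-nonPositive : ∀ {n} (A : Alg n) {l C} → l ≤ C → ErrorAtLeast A (ℕ→ℚ l - ℕ→ℚ C)
error-nonPositive {n} A {l} {C} l≤C =
  (λ _ → ℕ→ℚ 0) , x , play-outputs (λ _ → 0) A [] (λ _ → z≤n) , x , nonPositive
  where
  x : Fin n
  x = proj₁ (play A [])
  nonPositive : ℕ→ℚ l - ℕ→ℚ C ℚ.≤ ℕ→ℚ 0 - ℕ→ℚ 0
  nonPositive = subst (ℕ→ℚ l - ℕ→ℚ C ℚ.≤_) (ℚₚ.+-inverseʳ (ℕ→ℚ C))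
                      (ℚₚ.+-monoˡ-≤ (ℚ.- ℕ→ℚ C) (ℕ→ℚ-mono l≤C))

2^⌊log₂⌋≤ : ∀ m → 1 ≤ m → 2 ^ ⌊log₂ m ⌋ ≤ m
2^⌊log₂⌋≤ m = go m (<-wellFounded m)
  where
  go : ∀ m → Acc _<_ m → 1 ≤ m → 2 ^ ⌊log₂ m ⌋ ≤ m
  go 1                (acc _)   _ = ≤-refl
  go m@(suc (suc k))  (acc smaller) _ = begin
    2 ^ ⌊log₂ m ⌋           ≡⟨ cong (2 ^_) log-halves ⟩
    2 * 2 ^ ⌊log₂ ⌊ m /2⌋ ⌋  ≤⟨ *-monoʳ-≤ 2 (go ⌊ m /2⌋ (smaller (⌊n/2⌋<n (suc k))) (s≤s z≤n)) ⟩
    2 * ⌊ m /2⌋             ≤⟨ twice-half ⟩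
    m                       ∎
    where
    open ≤-Reasoning
    log-halves : ⌊log₂ m ⌋ ≡ suc ⌊log₂ ⌊ m /2⌋ ⌋
    log-halves = begin-equality
      ⌊log₂ m ⌋                 ≡⟨ m∸n+n≡m (⌊log₂⌋-mono-≤ {2} {m} (s≤s (s≤s z≤n))) ⟨
      ⌊log₂ m ⌋ ∸ 1 + 1         ≡⟨ +-comm _ 1 ⟩
      suc (⌊log₂ m ⌋ ∸ 1)       ≡⟨ cong suc (⌊log₂⌊n/2⌋⌋≡⌊log₂n⌋∸1 m) ⟨
      suc ⌊log₂ ⌊ m /2⌋ ⌋       ∎
    twice-half : 2 * ⌊ m /2⌋ ≤ m
    twice-half = begin
      ⌊ m /2⌋ + (⌊ m /2⌋ + 0)   ≡⟨ cong (⌊ m /2⌋ +_) (+-identityʳ _) ⟩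
      ⌊ m /2⌋ + ⌊ m /2⌋         ≤⟨ +-monoʳ-≤ ⌊ m /2⌋ (⌊n/2⌋≤⌈n/2⌉ m) ⟩
      ⌊ m /2⌋ + ⌈ m /2⌉         ≡⟨ ⌊n/2⌋+⌈n/2⌉≡n m ⟩
      m                         ∎

m<2^m : ∀ m → m < 2 ^ m
m<2^m zero    = s≤s z≤n
m<2^m (suc m) = +-mono-≤ (m^n>0 2 m) (≤-trans (m<2^m m) (m≤m+n (2 ^ m) 0))

⌊log₂⌋-positive : ∀ {m} → 1 ≤ ⌊log₂ m ⌋ → 1 ≤ m
⌊log₂⌋-positive {suc m} _ = s≤s z≤n

half-below : ∀ {b n} → 1 ≤ n → 2 * b ≤ n → b < n
half-below {zero}  1≤n _    = 1≤n
half-below {suc b} _   2b≤n = <-≤-trans (m<m+n (suc b) (s≤s z≤n)) 2b≤n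

-- An algorithm with 2·depth ≤ 2^a·n has error at least loglog n − C whenever
-- a + 6 ≤ C ≤ loglog n: the ball of radius L = loglog n − C around the output
-- of the adversary run is small, since (a + 6)·2^L ≤ 2^(C+L) ≤ ⌊log₂ n⌋.
large-error : ∀ {n} (A : Alg n) a C → 1 ≤ n → 2 * depth A ≤ 2 ^ a * n →
              suc (a + 5) ≤ C → C ≤ loglog n → ErrorAtLeast A (ℕ→ℚ (loglog n) - ℕ→ℚ C)
large-error {n} A a C 1≤n shallow a+6≤C C≤ll =
  subst (λ l → ErrorAtLeast A (ℕ→ℚ l - ℕ→ℚ C)) (m+[n∸m]≡n C≤ll)
        (adversary-error A C L (half-below 1≤n small-ball))
  where
  x : Fin n
  x = proj₁ (play A [])
  E : List (Edge n)
  E = proj₂ (play A [])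
  L N : ℕ
  L = loglog n ∸ C
  N = ⌊log₂ n ⌋
  short : 2 * length E ≤ 2 ^ a * n
  short = ≤-trans (*-monoʳ-≤ 2 (≤-trans (play-length A []) (≤-reflexive (+-identityʳ _)))) shallow
  budget : (1 + (a + 5)) * 2 ^ L ≤ N
  budget = begin
    (1 + (a + 5)) * 2 ^ L  ≤⟨ *-monoˡ-≤ (2 ^ L) (≤-trans a+6≤C (<⇒≤ (m<2^m C))) ⟩
    2 ^ C * 2 ^ L          ≡⟨ ^-distribˡ-+-* 2 C L ⟨
    2 ^ (C + L)            ≡⟨ cong (2 ^_) (m+[n∸m]≡n C≤ll) ⟩
    2 ^ loglog n           ≤⟨ 2^⌊log₂⌋≤ N (⌊log₂⌋-positive (≤-trans (≤-trans (s≤s z≤n) a+6≤C) C≤ll)) ⟩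
    N                      ∎
    where open ≤-Reasoning
  small-ball : 2 * ∣ ball E x L ∣ ≤ n
  small-ball = ball-small E (play-winnerNotBusier A [] tt) a N (2^⌊log₂⌋≤ n 1≤n) short x L 1 budget

mainTheorem17 : (A : (n : ℕ) → ⦃ NonZero n ⦄ → Alg n) →
                (∃₂ λ c n₀ → (n : ℕ) → ⦃ _ : NonZero n ⦄ → n₀ ≤ n → depth (A n) ≤ c * n) →
                ∃ λ C → (n : ℕ) → ⦃ _ : NonZero n ⦄ →
                  ErrorAtLeast (A n) (ℕ→ℚ (loglog n) - ℕ→ℚ C)
mainTheorem17 A (c , n₀ , linear) = C , error-bound
  where
  a C : ℕ
  a = 2 * c
  C = loglog n₀ + suc (a + 5)
  shallow : ∀ n ⦃ _ : NonZero n ⦄ → n₀ ≤ n → 2 * depth (A n) ≤ 2 ^ a * n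
  shallow n n₀≤n = begin
    2 * depth (A n)  ≤⟨ *-monoʳ-≤ 2 (linear n n₀≤n) ⟩
    2 * (c * n)      ≡⟨ *-assoc 2 c n ⟨
    a * n            ≤⟨ *-monoˡ-≤ n (<⇒≤ (m<2^m a)) ⟩
    2 ^ a * n        ∎
    where open ≤-Reasoning
  error-bound : (n : ℕ) → ⦃ _ : NonZero n ⦄ → ErrorAtLeast (A n) (ℕ→ℚ (loglog n) - ℕ→ℚ C)
  error-bound n with n₀ ≤? n | C ≤? loglog n
  ... | yes n₀≤n | yes C≤ll = large-error (A n) a C (>-nonZero⁻¹ n) (shallow n n₀≤n) (m≤n+m _ _) C≤ll
  ... | _        | no  C≰ll = error-nonPositive (A n) (<⇒≤ (≰⇒> C≰ll))
  ... | no  n₀≰n | yes _    = error-nonPositive (A n) (≤-trans loglog-n≤loglog-n₀ (m≤m+n _ _))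
    where
    loglog-n≤loglog-n₀ : loglog n ≤ loglog n₀
    loglog-n≤loglog-n₀ = ⌊log₂⌋-mono-≤ (⌊log₂⌋-mono-≤ (<⇒≤ (≰⇒> n₀≰n)))
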